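{- Let $n\in\mathbb{N}$ be odd with $n\geq 51$, and let $G=C_n(\{1,3,n-3,n-1\})$. Then $\lambda_{(3,2,1)}(G)\leq 13$.
   Context: For $n\ge 3$ and $S\subseteq\{1,\dots,n-1\}$ closed under $x\mapsto n-x$, the circulant $C_n(S)$ is the graph with vertex set $\{u_1,\dots,u_n\}$ in which $u_iu_j$ is an edge iff $|i-j|\in S$. An $L(3,2,1)$-labeling of a graph $G$ is a function $f:V(G)\to\mathbb{N}\cup\{0\}$ such that $|f(x)-f(y)|>3-\operatorname{dist}_G(x,y)$ for all distinct $x,y\in V(G)$. $\lambda_{(3,2,1)}(G)$ is the minimum, over all $L(3,2,1)$-labelings of $G$, of the difference between the largest and smallest label used. -}

module Defs where

open import Data.Nat using (ℕ; zero; suc; _+_; _*_; _≤_; _<_; _∸_; ∣_-_∣)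
open import Data.Fin using (Fin; toℕ)
open import Relation.Binary.PropositionalEquality using (_≡_)
open import Relation.Nullary using (¬_)
open import Data.Sum using (_⊎_)

Graph : ℕ → Set₁
Graph n = Fin n → Fin n → Set

data Walk {n : ℕ} (G : Graph n) : ℕ → Fin n → Fin n → Set where
  here : ∀ {x} → Walk G zero x x
  step : ∀ {m x y z} → G x y → Walk G m y z → Walk G (suc m) x z

DistAtMost : ∀ {n} → Graph n → ℕ → Fin n → Fin n → Set
DistAtMost G k x y = Σ' where
  open import Data.Product using (Σ; _×_)
  Σ' = Σ ℕ (λ m → m ≤ k × Walk G m x y)

-- Circulant C_n(S): vertices u_1..u_n (here indices 0..n-1, shift irrelevant),
-- u_i u_j an edge iff |i - j| ∈ S, S given as a predicate on ℕ.
Circulant : (n : ℕ) → (ℕ → Set) → Graph n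
Circulant n S i j = S ∣ toℕ i - toℕ j ∣

S13 : ℕ → ℕ → Set
S13 n d = (d ≡ 1) ⊎ (d ≡ 3) ⊎ (d ≡ n ∸ 3) ⊎ (d ≡ n ∸ 1)

-- L(3,2,1)-labeling: |f x - f y| > 3 - dist(x,y) for distinct x, y.
-- Since |f x - f y| ≥ 0, this is only a constraint when dist(x,y) ≤ 3, and
-- it is equivalent to: for every k ≤ 3 with dist(x,y) ≤ k, |f x - f y| > 3 - k.
IsL321 : ∀ {n} → Graph n → (Fin n → ℕ) → Set
IsL321 {n} G f = ∀ (x y : Fin n) → ¬ (x ≡ y) → ∀ (k : ℕ) → k ≤ 3 →
  DistAtMost G k x y → 3 ∸ k < ∣ f x - f y ∣

L321SpanAtMost : ∀ {n} → Graph n → ℕ → Set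
L321SpanAtMost {n} G b = Σ (Fin n → ℕ) (λ f → IsL321 G f × Σ ℕ (λ lo → ∀ v → lo ≤ f v × f v ≤ lo + b))
  where open import Data.Product using (Σ; _×_)

{-# OPTIONS --safe #-}
module Submission where

-- Label u_i by w_i for a cyclic word w over {0, …, 13}. A walk of k steps of size ±1 or ±3 has net
-- displacement d ≤ 3k with d ≡ k (mod 2), so for n ≥ 10 the labelling is L(3,2,1) as soon as
-- letters d ≤ 9 apart around the cycle differ by at least 4 − δ(d) ('gaps'), δ being the distance
-- from 0 to d in the Cayley graph of ℤ with generators ±1, ±3. That condition only
-- looks at windows of 10 letters, so if a 12-letter word p may follow itself and a base word v is
-- good both alone and after p, then every p^q v is good. Six base words of lengths 51, 53, …, 61
-- then give all odd n ≥ 51.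

open import Data.Nat using (ℕ; zero; suc; _+_; _*_; _∸_; _≤_; _<_; ∣_-_∣; z≤n; s≤s; _≤?_; _<?_; _≟_; NonZero; >-nonZero; _%_)
open import Data.Nat.Properties
open import Data.Nat.DivMod using (%-distribˡ-+; [m+kn]%n≡m%n; [m+n]%n≡m%n; m<n⇒m%n≡m; m≤n⇒[n∸m]%m≡n%m; result; _divMod_)
open import Data.Nat.Tactic.RingSolver using (solve)
open import Data.Fin using (Fin; toℕ; zero; suc)
open import Data.Fin.Properties using (toℕ<n; toℕ-injective)
import Data.Fin.Properties as Fin
open import Data.List using (List; []; _∷_; _++_; take; length; concat; replicate)
open import Data.List.Properties using (++-assoc; length-++; length-++-≤ʳ; length-take)
open import Data.List.Relation.Unary.All using (All)
import Data.List.Relation.Unary.All as All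
open import Data.List.Relation.Unary.All.Properties using (++⁺; concat⁺; replicate⁺)
open import Data.Product using (Σ; ∃; ∃₂; _×_; _,_; proj₁)
open import Data.Sum using (_⊎_; inj₁; inj₂)
open import Data.Unit using (⊤; tt)
open import Data.Empty using (⊥-elim)
open import Function using (_∘_)
open import Relation.Nullary using (Dec; yes; no)
open import Relation.Nullary.Decidable using (from-yes; _×-dec_; _→-dec_)
open import Relation.Binary.PropositionalEquality using (_≡_; _≢_; refl; sym; trans; cong; cong₂; subst; subst₂; module ≡-Reasoning)

open import Defs

_‼_ : List ℕ → ℕ → ℕ
[]       ‼ _     = 0
(x ∷ xs) ‼ zero  = x
(x ∷ xs) ‼ suc i = xs ‼ i

‼-++ˡ : ∀ xs {ys i} → i < length xs → (xs ++ ys) ‼ i ≡ xs ‼ i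
‼-++ˡ (x ∷ xs) {i = zero}  _         = refl
‼-++ˡ (x ∷ xs) {i = suc i} (s≤s i<) = ‼-++ˡ xs i<

‼-++ʳ : ∀ xs {ys} i → (xs ++ ys) ‼ (length xs + i) ≡ ys ‼ i
‼-++ʳ []       i = refl
‼-++ʳ (x ∷ xs) i = ‼-++ʳ xs i

‼-take : ∀ k xs {i} → i < k → take k xs ‼ i ≡ xs ‼ i
‼-take (suc k) []       _         = refl
‼-take (suc k) (x ∷ xs) {zero}  _         = refl
‼-take (suc k) (x ∷ xs) {suc i} (s≤s i<k) = ‼-take k xs i<k

take-++ˡ : ∀ {A : Set} k (xs : List A) {ys} → k ≤ length xs → take k (xs ++ ys) ≡ take k xs
take-++ˡ zero    xs       _         = refl
take-++ˡ (suc k) (x ∷ xs) (s≤s k≤) = cong (x ∷_) (take-++ˡ k xs k≤)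

-- gaps ‼ d = 4 − δ(d + 1), where δ(e) is the least m ≥ e/3 with m ≡ e (mod 2).
gaps : List ℕ
gaps = 3 ∷ 2 ∷ 3 ∷ 2 ∷ 1 ∷ 2 ∷ 1 ∷ 0 ∷ 1 ∷ []

FarFrom : ℕ → List ℕ → List ℕ → Set
FarFrom x (g ∷ gs) (y ∷ ys) = g ≤ ∣ x - y ∣ × FarFrom x gs ys
FarFrom x _        _        = ⊤

Spaced : List ℕ → Set
Spaced []       = ⊤
Spaced (x ∷ xs) = FarFrom x gaps xs × Spaced xs

-- Unrolling w by 9 letters compares each letter with the 9 following it around the cycle.
CyclicallySpaced : List ℕ → Set
CyclicallySpaced w = Spaced (w ++ take 9 w)

farFrom? : ∀ x gs ys → Dec (FarFrom x gs ys)
farFrom? x []       _        = yes tt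
farFrom? x (g ∷ gs) []       = yes tt
farFrom? x (g ∷ gs) (y ∷ ys) = (g ≤? ∣ x - y ∣) ×-dec farFrom? x gs ys

spaced? : ∀ xs → Dec (Spaced xs)
spaced? []       = yes tt
spaced? (x ∷ xs) = farFrom? x gaps xs ×-dec spaced? xs

cyclicallySpaced? : ∀ w → Dec (CyclicallySpaced w)
cyclicallySpaced? w = spaced? (w ++ take 9 w)

farFrom-++ : ∀ {x} gs xs {ys} → length gs ≤ length xs → FarFrom x gs xs → FarFrom x gs (xs ++ ys)
farFrom-++ []       _        _         _        = tt
farFrom-++ (g ∷ gs) (y ∷ xs) (s≤s gs≤) (h , hs) = h , farFrom-++ gs xs gs≤ hs

farFrom-‼ : ∀ {x} gs ys {i} → i < length gs → i < length ys → FarFrom x gs ys → gs ‼ i ≤ ∣ x - ys ‼ i ∣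
farFrom-‼ (g ∷ gs) (y ∷ ys) {zero}  _          _          (h , _)  = h
farFrom-‼ (g ∷ gs) (y ∷ ys) {suc i} (s≤s i<gs) (s≤s i<ys) (_ , hs) = farFrom-‼ gs ys i<gs i<ys hs

spaced-glue : ∀ xs {ys zs} → 9 ≤ length ys → Spaced (xs ++ ys) → Spaced (ys ++ zs) → Spaced (xs ++ ys ++ zs)
spaced-glue []       _      _          h = h
spaced-glue (x ∷ xs) {ys} {zs} 9≤ys (hx , hxs) h =
  subst (FarFrom x gaps) (++-assoc xs ys zs) (farFrom-++ gaps (xs ++ ys) (≤-trans 9≤ys (length-++-≤ʳ ys {xs})) hx)
  , spaced-glue xs 9≤ys hxs h

spaced-‼ : ∀ zs {i d} → d < 9 → i + suc d < length zs → Spaced zs → gaps ‼ d ≤ ∣ zs ‼ i - zs ‼ (i + suc d) ∣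
spaced-‼ (z ∷ zs) {zero}  d<9 (s≤s d<) (h , _) = farFrom-‼ gaps zs d<9 d< h
spaced-‼ (z ∷ zs) {suc i} {d} d<9 (s≤s i+d<) (_ , h) = spaced-‼ zs {i} {d} d<9 i+d< h

spaced-pump : ∀ {p s} → 9 ≤ length p → Spaced (p ++ p) → Spaced (p ++ s) →
              ∀ j → Spaced (p ++ concat (replicate j p) ++ s)
spaced-pump _ _ h zero = h
spaced-pump {p} {s} 9≤p hpp h (suc j) =
  subst (λ r → Spaced (p ++ r)) (sym (++-assoc p _ s)) (spaced-glue p 9≤p hpp (spaced-pump {p} {s} 9≤p hpp h j))

unroll-++ : ∀ (p r : List ℕ) → 9 ≤ length p → (p ++ r) ++ take 9 (p ++ r) ≡ p ++ r ++ take 9 p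
unroll-++ p r 9≤p = begin
  (p ++ r) ++ take 9 (p ++ r) ≡⟨ ++-assoc p r _ ⟩
  p ++ r ++ take 9 (p ++ r)   ≡⟨ cong (λ t → p ++ r ++ t) (take-++ˡ 9 p 9≤p) ⟩
  p ++ r ++ take 9 p          ∎
  where open ≡-Reasoning

cyclicallySpaced-pump : ∀ {p v} → 9 ≤ length p → Spaced (p ++ p) → CyclicallySpaced v → CyclicallySpaced (p ++ v) →
                        ∀ j → CyclicallySpaced (concat (replicate j p) ++ v)
cyclicallySpaced-pump _ _ hv _ zero = hv
cyclicallySpaced-pump {p} {v} 9≤p hpp _ hpv (suc j) =
  subst Spaced (sym unrolled) (spaced-pump {p} 9≤p hpp (subst Spaced (unroll-++ p v 9≤p) hpv) j)
  where
  open ≡-Reasoning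
  pʲ = concat (replicate j p)
  unrolled : ((p ++ pʲ) ++ v) ++ take 9 ((p ++ pʲ) ++ v) ≡ p ++ pʲ ++ v ++ take 9 p
  unrolled = begin
    ((p ++ pʲ) ++ v) ++ take 9 ((p ++ pʲ) ++ v) ≡⟨ cong (λ w → w ++ take 9 w) (++-assoc p pʲ v) ⟩
    (p ++ pʲ ++ v) ++ take 9 (p ++ pʲ ++ v)     ≡⟨ unroll-++ p (pʲ ++ v) 9≤p ⟩
    p ++ (pʲ ++ v) ++ take 9 p                  ≡⟨ cong (p ++_) (++-assoc pʲ v _) ⟩
    p ++ pʲ ++ v ++ take 9 p                    ∎

Ahead : ℕ → ℕ → ℕ → ℕ → Set
Ahead n d i j = i + d ≡ j ⊎ i + d ≡ n + j

cyclicallySpaced-ahead : ∀ w {i j d} → 9 ≤ length w → d < 9 → i < length w → j < length w →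
                         Ahead (length w) (suc d) i j → CyclicallySpaced w → gaps ‼ d ≤ ∣ w ‼ i - w ‼ j ∣
cyclicallySpaced-ahead w {i} {j} {d} 9≤n d<9 i<n j<n ahead h =
  subst₂ (λ a b → gaps ‼ d ≤ ∣ a - b ∣) (‼-++ˡ w i<n) (unrolled-‼ ahead) (spaced-‼ (w ++ take 9 w) d<9 in-range h)
  where
  n = length w
  i+d<n+9 : i + suc d < n + 9
  i+d<n+9 = +-mono-<-≤ i<n d<9
  in-range : i + suc d < length (w ++ take 9 w)
  in-range = subst (i + suc d <_) (sym (trans (length-++ w) (cong (n +_) (trans (length-take 9 w) (m≤n⇒m⊓n≡m 9≤n)))))
                   i+d<n+9
  unrolled-‼ : Ahead n (suc d) i j → (w ++ take 9 w) ‼ (i + suc d) ≡ w ‼ j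
  unrolled-‼ (inj₁ refl) = ‼-++ˡ w j<n
  unrolled-‼ (inj₂ wraps) = begin
    (w ++ take 9 w) ‼ (i + suc d) ≡⟨ cong ((w ++ take 9 w) ‼_) wraps ⟩
    (w ++ take 9 w) ‼ (n + j)     ≡⟨ ‼-++ʳ w j ⟩
    take 9 w ‼ j                  ≡⟨ ‼-take 9 w (+-cancelˡ-< n j 9 (subst (_< n + 9) wraps i+d<n+9)) ⟩
    w ‼ j                         ∎
    where open ≡-Reasoning

+-congʳ-mod : ∀ a b c {n} .{{_ : NonZero n}} → a % n ≡ b % n → (a + c) % n ≡ (b + c) % n
+-congʳ-mod a b c {n} a≡b = begin
  (a + c) % n         ≡⟨ %-distribˡ-+ a c n ⟩
  (a % n + c % n) % n ≡⟨ cong (λ r → (r + c % n) % n) a≡b ⟩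
  (b % n + c % n) % n ≡⟨ %-distribˡ-+ b c n ⟨
  (b + c) % n         ∎
  where open ≡-Reasoning

+-cancelʳ-mod : ∀ a b c {n} .{{_ : NonZero n}} → (a + c) % n ≡ (b + c) % n → a % n ≡ b % n
+-cancelʳ-mod a b c {n@(suc n-1)} a+c≡b+c = begin
  a % n                   ≡⟨ [m+kn]%n≡m%n a c n ⟨
  (a + c * n) % n         ≡⟨ cong (_% n) (split a) ⟩
  (a + c + c * n-1) % n   ≡⟨ +-congʳ-mod (a + c) (b + c) (c * n-1) a+c≡b+c ⟩
  (b + c + c * n-1) % n   ≡⟨ cong (_% n) (split b) ⟨
  (b + c * n) % n         ≡⟨ [m+kn]%n≡m%n b c n ⟩
  b % n                   ∎
  where
  open ≡-Reasoning
  split : ∀ r → r + c * n ≡ r + c + c * n-1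
  split r = solve (r ∷ c ∷ n-1 ∷ [])

∣-∣≡⇒ : ∀ {a b c} → ∣ a - b ∣ ≡ c → a + c ≡ b ⊎ b + c ≡ a
∣-∣≡⇒ {a} {b} refl with ≤-total a b
... | inj₁ a≤b = inj₁ (trans (cong (a +_) (m≤n⇒∣m-n∣≡n∸m a≤b)) (m+[n∸m]≡n a≤b))
... | inj₂ b≤a = inj₂ (trans (cong (b +_) (m≤n⇒∣n-m∣≡n∸m b≤a)) (m+[n∸m]≡n b≤a))

-- s and t are the backward total and the number of 3-steps of an m-step walk with net
-- displacement d + 1 (see Drift below).
gap-sound : ∀ {m t s d} → m ≤ 3 → t ≤ m → suc d + (s + s) ≡ m + (t + t) → d < 9 × 3 ∸ m < gaps ‼ d
gap-sound {m} {t} {s} {d} m≤3 t≤m total = d<9 , table (s≤s m≤3) (s≤s t≤3) (s≤s s≤9) d<9 t≤m total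
  where
  t≤3 = ≤-trans t≤m m≤3
  ≤9 : suc d + (s + s) ≤ 9
  ≤9 = subst (_≤ 9) (sym total) (+-mono-≤ m≤3 (+-mono-≤ t≤3 t≤3))
  d<9 : d < 9
  d<9 = m+n≤o⇒m≤o (suc d) ≤9
  s≤9 : s ≤ 9
  s≤9 = m+n≤o⇒m≤o s (m+n≤o⇒n≤o (suc d) ≤9)
  table : ∀ {m} → m < 4 → ∀ {t} → t < 4 → ∀ {s} → s < 10 → ∀ {d} → d < 9 →
          t ≤ m → suc d + (s + s) ≡ m + (t + t) → 3 ∸ m < gaps ‼ d
  table = from-yes (allUpTo? (λ m → allUpTo? (λ t → allUpTo? (λ s → allUpTo? (λ d →
            (t ≤? m) →-dec ((suc d + (s + s) ≟ m + (t + t)) →-dec (3 ∸ m <? gaps ‼ d))) 9) 10) 4) 4)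

module _ (n : ℕ) (10≤n : 10 ≤ n) where

  private
    1≤n : 1 ≤ n
    1≤n = ≤-trans (s≤s z≤n) 10≤n

    3≤n : 3 ≤ n
    3≤n = ≤-trans (s≤s (s≤s (s≤s z≤n))) 10≤n

    9≤n : 9 ≤ n
    9≤n = ≤-trans (n≤1+n 9) 10≤n

    instance
      n-nonZero : NonZero n
      n-nonZero = >-nonZero 1≤n

  record Drift (m x y : ℕ) : Set where
    constructor drift
    field
      forward backward threes : ℕ
      threes≤m : threes ≤ m
      total : forward + backward ≡ m + (threes + threes)
      lands : (x + forward) % n ≡ (y + backward) % n

  drift-sym : ∀ {m x y} → Drift m x y → Drift m y x
  drift-sym (drift f b t t≤m total lands) = drift b f t t≤m (trans (+-comm b f) total) (sym lands)

  drift-trans : ∀ {m k x y z} → Drift m x y → Drift k y z → Drift (m + k) x z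
  drift-trans {m} {k} {x} {y} {z} (drift f₁ b₁ t₁ t₁≤m total₁ lands₁) (drift f₂ b₂ t₂ t₂≤k total₂ lands₂) =
    drift (f₁ + f₂) (b₁ + b₂) (t₁ + t₂) (+-mono-≤ t₁≤m t₂≤k) total lands
    where
    open ≡-Reasoning
    total : (f₁ + f₂) + (b₁ + b₂) ≡ (m + k) + ((t₁ + t₂) + (t₁ + t₂))
    total = begin
      (f₁ + f₂) + (b₁ + b₂)               ≡⟨ solve (f₁ ∷ f₂ ∷ b₁ ∷ b₂ ∷ []) ⟩
      (f₁ + b₁) + (f₂ + b₂)               ≡⟨ cong₂ _+_ total₁ total₂ ⟩
      (m + (t₁ + t₁)) + (k + (t₂ + t₂))   ≡⟨ solve (m ∷ k ∷ t₁ ∷ t₂ ∷ []) ⟩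
      (m + k) + ((t₁ + t₂) + (t₁ + t₂))   ∎
    lands : (x + (f₁ + f₂)) % n ≡ (z + (b₁ + b₂)) % n
    lands = begin
      (x + (f₁ + f₂)) % n ≡⟨ cong (_% n) (sym (+-assoc x f₁ f₂)) ⟩
      (x + f₁ + f₂) % n   ≡⟨ +-congʳ-mod (x + f₁) (y + b₁) f₂ lands₁ ⟩
      (y + b₁ + f₂) % n   ≡⟨ cong (_% n) (solve (y ∷ b₁ ∷ f₂ ∷ [])) ⟩
      (y + f₂ + b₁) % n   ≡⟨ +-congʳ-mod (y + f₂) (z + b₂) b₁ lands₂ ⟩
      (z + b₂ + b₁) % n   ≡⟨ cong (_% n) (solve (z ∷ b₂ ∷ b₁ ∷ [])) ⟩
      (z + (b₁ + b₂)) % n ∎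

  forward-% : ∀ {a b s} → s ≤ n → a + s ≡ b ⊎ b + (n ∸ s) ≡ a → (a + s) % n ≡ (b + 0) % n
  forward-% {a} {b} {s} _   (inj₁ a+s≡b) = cong (_% n) (trans a+s≡b (sym (+-identityʳ b)))
  forward-% {a} {b} {s} s≤n (inj₂ b+[n∸s]≡a) = begin
    (a + s) % n           ≡⟨ cong (λ r → (r + s) % n) b+[n∸s]≡a ⟨
    (b + (n ∸ s) + s) % n ≡⟨ cong (_% n) (trans (+-assoc b (n ∸ s) s) (cong (b +_) (m∸n+n≡m s≤n))) ⟩
    (b + n) % n           ≡⟨ [m+n]%n≡m%n b n ⟩
    b % n                 ≡⟨ cong (_% n) (+-identityʳ b) ⟨
    (b + 0) % n           ∎
    where open ≡-Reasoning

  forward-step : ∀ {a b} s t → t ≤ 1 → s ≡ suc (t + t) → s ≤ n → a + s ≡ b ⊎ b + (n ∸ s) ≡ a → Drift 1 a b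
  forward-step s t t≤1 s≡ s≤n h = drift s 0 t t≤1 (trans (+-identityʳ s) s≡) (forward-% s≤n h)

  step-drift : ∀ {x y} s t → t ≤ 1 → s ≡ suc (t + t) → s ≤ n → ∣ x - y ∣ ≡ s ⊎ ∣ x - y ∣ ≡ n ∸ s → Drift 1 x y
  step-drift s t t≤1 s≡ s≤n (inj₁ e) with ∣-∣≡⇒ e
  ... | inj₁ x+s≡y     = forward-step s t t≤1 s≡ s≤n (inj₁ x+s≡y)
  ... | inj₂ y+s≡x     = drift-sym (forward-step s t t≤1 s≡ s≤n (inj₁ y+s≡x))
  step-drift s t t≤1 s≡ s≤n (inj₂ e) with ∣-∣≡⇒ e
  ... | inj₁ x+[n∸s]≡y = drift-sym (forward-step s t t≤1 s≡ s≤n (inj₂ x+[n∸s]≡y))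
  ... | inj₂ y+[n∸s]≡x = forward-step s t t≤1 s≡ s≤n (inj₂ y+[n∸s]≡x)

  edge⇒drift : ∀ {x y} → S13 n ∣ x - y ∣ → Drift 1 x y
  edge⇒drift (inj₁ e)               = step-drift 1 0 z≤n refl 1≤n (inj₁ e)
  edge⇒drift (inj₂ (inj₁ e))        = step-drift 3 1 ≤-refl refl 3≤n (inj₁ e)
  edge⇒drift (inj₂ (inj₂ (inj₁ e))) = step-drift 3 1 ≤-refl refl 3≤n (inj₂ e)
  edge⇒drift (inj₂ (inj₂ (inj₂ e))) = step-drift 1 0 z≤n refl 1≤n (inj₂ e)

  walk⇒drift : ∀ {m x y} → Walk (Circulant n (S13 n)) m x y → Drift m (toℕ x) (toℕ y)
  walk⇒drift here       = drift 0 0 0 z≤n refl refl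
  walk⇒drift (step e w) = drift-trans (edge⇒drift e) (walk⇒drift w)

  %⇒ahead : ∀ {x d} → x < n → d ≤ n → Ahead n d x ((x + d) % n)
  %⇒ahead {x} {d} x<n d≤n with x + d <? n
  ... | yes x+d<n = inj₁ (sym (m<n⇒m%n≡m x+d<n))
  ... | no  x+d≮n = inj₂ (begin
    x + d                 ≡⟨ m+[n∸m]≡n n≤x+d ⟨
    n + (x + d ∸ n)       ≡⟨ cong (n +_) wrapped ⟨
    n + (x + d) % n       ∎)
    where
    open ≡-Reasoning
    n≤x+d = ≮⇒≥ x+d≮n
    wrapped : (x + d) % n ≡ x + d ∸ n
    wrapped = trans (sym (m≤n⇒[n∸m]%m≡n%m n≤x+d)) (m<n⇒m%n≡m (m<n+o⇒m∸n<o (x + d) n (+-mono-<-≤ x<n d≤n)))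

  drift⇒ahead : ∀ {m x y} (δ : Drift m x y) → Drift.backward δ ≤ Drift.forward δ → m ≤ 3 → x < n → y < n → x ≢ y →
                ∃ λ d → (d < 9 × 3 ∸ m < gaps ‼ d) × Ahead n (suc d) x y
  drift⇒ahead {m} {x} {y} (drift f b t t≤m total lands) b≤f m≤3 x<n y<n x≢y = advance (f ∸ b) net-total net-lands
    where
    net-total : (f ∸ b) + (b + b) ≡ m + (t + t)
    net-total = trans (sym (+-assoc (f ∸ b) b b)) (trans (cong (_+ b) (m∸n+n≡m b≤f)) total)
    net-lands : (x + (f ∸ b)) % n ≡ y
    net-lands = trans (+-cancelʳ-mod (x + (f ∸ b)) y b
                        (trans (cong (_% n) (trans (+-assoc x (f ∸ b) b) (cong (x +_) (m∸n+n≡m b≤f)))) lands))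
                      (m<n⇒m%n≡m y<n)
    advance : ∀ D → D + (b + b) ≡ m + (t + t) → (x + D) % n ≡ y → ∃ λ d → (d < 9 × 3 ∸ m < gaps ‼ d) × Ahead n (suc d) x y
    advance zero    _      x≡y  = ⊥-elim (x≢y (trans (sym (m<n⇒m%n≡m x<n)) (trans (cong (_% n) (sym (+-identityʳ x))) x≡y)))
    advance (suc d) total′ refl = d , gap , %⇒ahead x<n (≤-trans (proj₁ gap) 9≤n)
      where gap = gap-sound {s = b} m≤3 t≤m total′

  circulant-isL321 : (f : Fin n → ℕ) →
                   (∀ {x y d} → d < 9 → Ahead n (suc d) (toℕ x) (toℕ y) → gaps ‼ d ≤ ∣ f x - f y ∣) →
                   IsL321 (Circulant n (S13 n)) f
  circulant-isL321 f respects x y x≢y k k≤3 (m , m≤k , walk) = ≤-<-trans (∸-monoʳ-≤ 3 m≤k) 3∸m<∣fx-fy∣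
    where
    m≤3 = ≤-trans m≤k k≤3
    separated : ∀ {x y} → x ≢ y → (δ : Drift m (toℕ x) (toℕ y)) → Drift.backward δ ≤ Drift.forward δ → 3 ∸ m < ∣ f x - f y ∣
    separated {x} {y} x≢y δ b≤f with drift⇒ahead δ b≤f m≤3 (toℕ<n x) (toℕ<n y) (x≢y ∘ toℕ-injective)
    ... | d , (d<9 , gap) , ahead = <-≤-trans gap (respects d<9 ahead)
    δ = walk⇒drift walk
    3∸m<∣fx-fy∣ : 3 ∸ m < ∣ f x - f y ∣
    3∸m<∣fx-fy∣ with ≤-total (Drift.backward δ) (Drift.forward δ)
    ... | inj₁ b≤f = separated x≢y δ b≤f
    ... | inj₂ f≤b = subst (3 ∸ m <_) (∣-∣-comm (f y) (f x)) (separated (x≢y ∘ sym) (drift-sym δ) f≤b)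

‼-≤ : ∀ {b w} → All (_≤ b) w → ∀ i → w ‼ i ≤ b
‼-≤ All.[]         _       = z≤n
‼-≤ (p All.∷ _)    zero    = p
‼-≤ (_ All.∷ ps)   (suc i) = ‼-≤ ps i

cyclicallySpaced⇒L321SpanAtMost : ∀ w {b} → 10 ≤ length w → CyclicallySpaced w → All (_≤ b) w →
                                  L321SpanAtMost (Circulant (length w) (S13 (length w))) b
cyclicallySpaced⇒L321SpanAtMost w 10≤n spaced bounded =
  label , circulant-isL321 (length w) 10≤n label respects , 0 , λ x → z≤n , ‼-≤ bounded (toℕ x)
  where
  label : Fin (length w) → ℕ
  label x = w ‼ toℕ x
  respects : ∀ {x y d} → d < 9 → Ahead (length w) (suc d) (toℕ x) (toℕ y) → gaps ‼ d ≤ ∣ label x - label y ∣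
  respects {x} {y} d<9 ahead = cyclicallySpaced-ahead w (≤-trans (n≤1+n 9) 10≤n) d<9 (toℕ<n x) (toℕ<n y) ahead spaced

period : List ℕ
period = 0 ∷ 7 ∷ 13 ∷ 5 ∷ 11 ∷ 3 ∷ 9 ∷ 1 ∷ 6 ∷ 12 ∷ 4 ∷ 10 ∷ []

baseWord : Fin 6 → List ℕ
baseWord zero =
  2 ∷ 7 ∷ 0 ∷ 5 ∷ 11 ∷ 3 ∷ 8 ∷ 1 ∷ 6 ∷ 13 ∷ 4 ∷ 9 ∷ 0 ∷ 7 ∷ 12 ∷ 3 ∷ 10 ∷ 1 ∷ 6 ∷ 13 ∷ 4 ∷ 9 ∷ 0 ∷
  7 ∷ 12 ∷ 5 ∷ 10 ∷ 1 ∷ 8 ∷ 13 ∷ 6 ∷ 11 ∷ 3 ∷ 9 ∷ 0 ∷ 7 ∷ 12 ∷ 4 ∷ 10 ∷ 2 ∷ 8 ∷ 13 ∷ 5 ∷ 11 ∷ 3 ∷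
  9 ∷ 1 ∷ 6 ∷ 12 ∷ 4 ∷ 10 ∷ []
baseWord (suc zero) =
  0 ∷ 7 ∷ 13 ∷ 5 ∷ 11 ∷ 3 ∷ 9 ∷ 1 ∷ 6 ∷ 12 ∷ 4 ∷ 10 ∷ 0 ∷ 7 ∷ 13 ∷ 5 ∷ 11 ∷ 3 ∷ 8 ∷ 1 ∷ 6 ∷ 12 ∷
  4 ∷ 9 ∷ 2 ∷ 7 ∷ 0 ∷ 5 ∷ 10 ∷ 3 ∷ 8 ∷ 13 ∷ 6 ∷ 11 ∷ 1 ∷ 9 ∷ 4 ∷ 7 ∷ 12 ∷ 0 ∷ 10 ∷ 2 ∷ 8 ∷ 13 ∷ 5 ∷
  11 ∷ 3 ∷ 9 ∷ 1 ∷ 6 ∷ 12 ∷ 4 ∷ 10 ∷ []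
baseWord (suc (suc zero)) =
  0 ∷ 7 ∷ 13 ∷ 5 ∷ 11 ∷ 1 ∷ 8 ∷ 3 ∷ 6 ∷ 12 ∷ 0 ∷ 9 ∷ 4 ∷ 7 ∷ 13 ∷ 1 ∷ 10 ∷ 5 ∷ 8 ∷ 3 ∷ 0 ∷ 11 ∷ 6 ∷
  9 ∷ 4 ∷ 13 ∷ 2 ∷ 7 ∷ 0 ∷ 5 ∷ 10 ∷ 3 ∷ 8 ∷ 13 ∷ 6 ∷ 11 ∷ 1 ∷ 9 ∷ 4 ∷ 7 ∷ 12 ∷ 0 ∷ 10 ∷ 2 ∷ 8 ∷
  13 ∷ 5 ∷ 11 ∷ 3 ∷ 9 ∷ 1 ∷ 6 ∷ 12 ∷ 4 ∷ 10 ∷ []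
baseWord (suc (suc (suc zero))) =
  2 ∷ 7 ∷ 13 ∷ 5 ∷ 0 ∷ 3 ∷ 8 ∷ 11 ∷ 6 ∷ 1 ∷ 4 ∷ 9 ∷ 12 ∷ 7 ∷ 2 ∷ 5 ∷ 0 ∷ 13 ∷ 10 ∷ 3 ∷ 6 ∷ 1 ∷ 8 ∷
  11 ∷ 4 ∷ 13 ∷ 0 ∷ 9 ∷ 2 ∷ 7 ∷ 12 ∷ 5 ∷ 10 ∷ 1 ∷ 8 ∷ 13 ∷ 6 ∷ 11 ∷ 3 ∷ 9 ∷ 0 ∷ 7 ∷ 12 ∷ 4 ∷ 10 ∷
  2 ∷ 8 ∷ 13 ∷ 5 ∷ 11 ∷ 3 ∷ 9 ∷ 1 ∷ 6 ∷ 12 ∷ 4 ∷ 10 ∷ []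
baseWord (suc (suc (suc (suc zero)))) =
  2 ∷ 8 ∷ 13 ∷ 5 ∷ 11 ∷ 3 ∷ 9 ∷ 0 ∷ 7 ∷ 12 ∷ 4 ∷ 10 ∷ 1 ∷ 8 ∷ 13 ∷ 6 ∷ 11 ∷ 0 ∷ 9 ∷ 2 ∷ 7 ∷ 4 ∷
  13 ∷ 10 ∷ 1 ∷ 8 ∷ 5 ∷ 12 ∷ 3 ∷ 0 ∷ 9 ∷ 6 ∷ 11 ∷ 4 ∷ 13 ∷ 2 ∷ 7 ∷ 0 ∷ 5 ∷ 12 ∷ 3 ∷ 8 ∷ 1 ∷ 6 ∷
  13 ∷ 4 ∷ 10 ∷ 2 ∷ 7 ∷ 0 ∷ 5 ∷ 11 ∷ 3 ∷ 9 ∷ 1 ∷ 6 ∷ 12 ∷ 4 ∷ 10 ∷ []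
baseWord (suc (suc (suc (suc (suc zero))))) =
  2 ∷ 7 ∷ 0 ∷ 5 ∷ 11 ∷ 3 ∷ 8 ∷ 1 ∷ 6 ∷ 13 ∷ 4 ∷ 9 ∷ 0 ∷ 7 ∷ 12 ∷ 3 ∷ 10 ∷ 1 ∷ 6 ∷ 13 ∷ 4 ∷ 9 ∷ 0 ∷
  7 ∷ 12 ∷ 3 ∷ 10 ∷ 1 ∷ 6 ∷ 13 ∷ 4 ∷ 9 ∷ 0 ∷ 7 ∷ 12 ∷ 5 ∷ 10 ∷ 1 ∷ 8 ∷ 13 ∷ 6 ∷ 11 ∷ 3 ∷ 9 ∷ 0 ∷
  7 ∷ 12 ∷ 4 ∷ 10 ∷ 2 ∷ 8 ∷ 13 ∷ 5 ∷ 11 ∷ 3 ∷ 9 ∷ 1 ∷ 6 ∷ 12 ∷ 4 ∷ 10 ∷ []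

period-spaced : Spaced (period ++ period)
period-spaced = from-yes (spaced? (period ++ period))

period-bounded : All (_≤ 13) period
period-bounded = from-yes (All.all? (_≤? 13) period)

length-baseWord : ∀ r → length (baseWord r) ≡ 51 + 2 * toℕ r
length-baseWord = from-yes (Fin.all? λ r → length (baseWord r) ≟ 51 + 2 * toℕ r)

baseWord-cyclicallySpaced : ∀ r → CyclicallySpaced (baseWord r)
baseWord-cyclicallySpaced = from-yes (Fin.all? (cyclicallySpaced? ∘ baseWord))

period++baseWord-cyclicallySpaced : ∀ r → CyclicallySpaced (period ++ baseWord r)
period++baseWord-cyclicallySpaced = from-yes (Fin.all? λ r → cyclicallySpaced? (period ++ baseWord r))

baseWord-bounded : ∀ r → All (_≤ 13) (baseWord r)
baseWord-bounded = from-yes (Fin.all? (All.all? (_≤? 13) ∘ baseWord))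

labelWord : ℕ → Fin 6 → List ℕ
labelWord q r = concat (replicate q period) ++ baseWord r

length-concat-replicate : ∀ q (p : List ℕ) → length (concat (replicate q p)) ≡ q * length p
length-concat-replicate zero    p = refl
length-concat-replicate (suc q) p = trans (length-++ p) (cong (length p +_) (length-concat-replicate q p))

length-labelWord : ∀ q r → length (labelWord q r) ≡ q * 12 + (51 + 2 * toℕ r)
length-labelWord q r = begin
  length (labelWord q r)                                          ≡⟨ length-++ (concat (replicate q period)) ⟩
  length (concat (replicate q period)) + length (baseWord r)      ≡⟨ cong₂ _+_ (length-concat-replicate q period) (length-baseWord r) ⟩
  q * 12 + (51 + 2 * toℕ r)                                       ∎
  where open ≡-Reasoning

labelWord-cyclicallySpaced : ∀ q r → CyclicallySpaced (labelWord q r)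
labelWord-cyclicallySpaced q r =
  cyclicallySpaced-pump {period} {baseWord r} (m≤m+n 9 3) period-spaced
    (baseWord-cyclicallySpaced r) (period++baseWord-cyclicallySpaced r) q

labelWord-bounded : ∀ q r → All (_≤ 13) (labelWord q r)
labelWord-bounded q r = ++⁺ (concat⁺ (replicate⁺ q period-bounded)) (baseWord-bounded r)

odd-decomposition : ∀ {n k} → 51 ≤ n → n ≡ 2 * k + 1 → ∃₂ λ q (r : Fin 6) → n ≡ q * 12 + (51 + 2 * toℕ r)
odd-decomposition {k = k} 51≤n refl with (k ∸ 25) divMod 6
... | result q r k∸25≡ = q , r , (begin
  2 * k + 1                        ≡⟨ cong (λ j → 2 * j + 1) (m+[n∸m]≡n 25≤k) ⟨
  2 * (25 + (k ∸ 25)) + 1          ≡⟨ cong (λ j → 2 * (25 + j) + 1) k∸25≡ ⟩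
  2 * (25 + (toℕ r + q * 6)) + 1   ≡⟨ regroup (toℕ r) q ⟩
  q * 12 + (51 + 2 * toℕ r)        ∎)
  where
  open ≡-Reasoning
  25≤k : 25 ≤ k
  25≤k = *-cancelˡ-≤ 2 (+-cancelʳ-≤ 1 50 (2 * k) 51≤n)
  regroup : ∀ a b → 2 * (25 + (a + b * 6)) + 1 ≡ b * 12 + (51 + 2 * a)
  regroup a b = solve (a ∷ b ∷ [])

mainTheorem6 : (n : ℕ) → 51 ≤ n → (Σ ℕ λ k → n ≡ 2 * k + 1) →
    L321SpanAtMost (Circulant n (S13 n)) 13
mainTheorem6 n 51≤n (k , n≡2k+1) with odd-decomposition {k = k} 51≤n n≡2k+1
... | q , r , n≡ =
  subst (λ n → L321SpanAtMost (Circulant n (S13 n)) 13) (trans (length-labelWord q r) (sym n≡))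
        (cyclicallySpaced⇒L321SpanAtMost (labelWord q r) 10≤n (labelWord-cyclicallySpaced q r) (labelWord-bounded q r))
  where
  10≤n : 10 ≤ length (labelWord q r)
  10≤n = subst (10 ≤_) (trans n≡ (sym (length-labelWord q r))) (≤-trans (m≤m+n 10 41) 51≤n)
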